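{- Let $r$ be a positive integer, $J \subseteq 2^{[r]}$, and let $H^*$ be an $n$-vertex $J$-homogeneous $r$-graph with $\rho(J) = k$. Then $|H^*| \leq \binom{n}{k}$.
   Context: An $r$-graph is a family of $r$-element subsets (edges) of a finite vertex set. A Delta-system is a family $\triangle$ of sets such that for any distinct $e,f \in \triangle$, $e \cap f = \bigcap_{g \in \triangle} g$; this common intersection is its core. For an $r$-graph $H$ and a vertex set $f$, the core degree $d^*_H(f)$ is the maximum $s$ such that $H$ contains a Delta-system of $s$ edges with core $f$. For an edge $e$, let $H|_e = \{e \cap f : f \in H, f \neq e\}$. If $H$ is $r$-partite with parts $(X_1,\dots,X_r)$ (every edge meets each part in exactly one vertex), the projection of a set $g$ is $\mathrm{proj}(g) = \{i : g \cap X_i \neq \emptyset\}$, and the intersection pattern of $e$ is $I_H(e) = \{\mathrm{proj}(g) : g \in H|_e\} \subseteq 2^{[r]}$. For a positive integer $s$ and $J \subseteq 2^{[r]}$, an $r$-partite $r$-graph $H^*$ with parts $(X_1,\dots,X_r)$ is $(s,J)$-homogeneous if (1) $J$ is closed under intersection, (2) $I_{H^*}(e) = J$ for every $e \in H^*$, and (3) for every $e \in H^*$ and every $g \in H^*|_e$, $d^*_{H^*}(g) \geq s$. It is $J$-homogeneous if it is $(s,J)$-homogeneous for some positive integer $s$. The rank of $J \subseteq 2^{[r]}$ is $\rho(J) = \min\{|e| : e \subseteq [r],\ \text{no member of } J \text{ contains } e\}$. -}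

module Defs where

open import Data.Nat using (ℕ; _≤_)
open import Data.Fin using (Fin; _≟_)
open import Data.Fin.Subset using (Subset; _∩_; ⋂; ∣_∣; _⊆_)
open import Data.Fin.Subset.Properties using (nonempty?)
open import Data.Vec using (tabulate)
open import Data.List using (List; length)
open import Data.List.Membership.Propositional renaming (_∈_ to _∈ᴸ_)
open import Data.List.Relation.Unary.All using (All)
open import Data.List.Relation.Unary.Unique.Propositional using (Unique)
open import Data.Product using (Σ; ∃; _×_)
open import Function.Bundles using (_⇔_)
open import Relation.Nullary using (¬_)
open import Relation.Nullary.Decidable using (⌊_⌋)
open import Relation.Binary.PropositionalEquality using (_≡_; _≢_)

-- An r-graph on the vertex set Fin n is a finite family of r-element subsets,
-- represented as a duplicate-free list (so |H| = length H).
-- An r-partite structure with parts (X_1,...,X_r) is given by a map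
-- part : Fin n → Fin r assigning each vertex its part; X i = {v | part v = i}.

Family : ℕ → Set
Family n = List (Subset n)

X : ∀ {n r} → (Fin n → Fin r) → Fin r → Subset n
X part i = tabulate (λ v → ⌊ part v ≟ i ⌋)

IsRPartite : ∀ {n} (r : ℕ) → (Fin n → Fin r) → Family n → Set
IsRPartite r part H =
  Unique H ×
  All (λ e → (∣ e ∣ ≡ r) × (∀ i → ∣ e ∩ X part i ∣ ≡ 1)) H

proj : ∀ {n r} → (Fin n → Fin r) → Subset n → Subset r
proj part g = tabulate (λ i → ⌊ nonempty? (g ∩ X part i) ⌋)

InTrace : ∀ {n} → Family n → Subset n → Subset n → Set
InTrace H e g = ∃ λ f → (f ∈ᴸ H) × (f ≢ e) × (g ≡ e ∩ f)

InPattern : ∀ {n r} → (Fin n → Fin r) → Family n → Subset n → Subset r → Set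
InPattern part H e A = ∃ λ g → InTrace H e g × (proj part g ≡ A)

IsDeltaSystem : ∀ {n} → Family n → Subset n → Set
IsDeltaSystem Δ c =
  (∀ {e f} → e ∈ᴸ Δ → f ∈ᴸ Δ → e ≢ f → e ∩ f ≡ ⋂ Δ) × (⋂ Δ ≡ c)

-- d*_H(g) ≥ s : H contains a Delta-system with core g of at least s edges
-- (equivalent to "the maximum such size is ≥ s", the maximum existing by finiteness)
CoreDegreeAtLeast : ∀ {n} → Family n → Subset n → ℕ → Set
CoreDegreeAtLeast H g s =
  ∃ λ Δ → Unique Δ × All (_∈ᴸ H) Δ × IsDeltaSystem Δ g × (s ≤ length Δ)

FamilyR : ℕ → Set₁
FamilyR r = Subset r → Set

ClosedUnderIntersection : ∀ {r} → FamilyR r → Set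
ClosedUnderIntersection J = ∀ A B → J A → J B → J (A ∩ B)

IsHomogeneousWith : ∀ {n r} → (Fin n → Fin r) → ℕ → FamilyR r → Family n → Set
IsHomogeneousWith part s J H =
  ClosedUnderIntersection J ×
  (∀ e → e ∈ᴸ H → ∀ A → (InPattern part H e A ⇔ J A)) ×
  (∀ e → e ∈ᴸ H → ∀ g → InTrace H e g → CoreDegreeAtLeast H g s)

IsHomogeneous : ∀ {n r} → (Fin n → Fin r) → FamilyR r → Family n → Set
IsHomogeneous part J H = ∃ λ s → (1 ≤ s) × IsHomogeneousWith part s J H

Uncovered : ∀ {r} → FamilyR r → Subset r → Set
Uncovered J e = ∀ A → J A → ¬ (e ⊆ A)

RankIs : ∀ {r} → FamilyR r → ℕ → Set
RankIs J k =
  (∃ λ e → Uncovered J e × (∣ e ∣ ≡ k)) ×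
  (∀ e → Uncovered J e → k ≤ ∣ e ∣)

-- Fix a set K of parts with |K| = ρ(J) = k that no member of J covers, and send every edge e to
-- its trace on the union of the parts in K.  Each trace is a k-set, since an edge meets every
-- part exactly once.  Two distinct edges e, f with the same trace would have e ∩ f meeting every
-- part in K, so proj(e ∩ f) ⊇ K; but proj(e ∩ f) ∈ I(e) = J, contradicting the choice of K.
-- Hence the traces are distinct k-subsets of an n-set.
module Submission where

open import Defs
open import Data.Bool using (Bool; true; false; _∧_)
open import Data.Nat using (ℕ; zero; suc; _+_; _*_; _≤_; z≤n; s≤s)
open import Data.Nat.Properties
  using ( +-*-semiring; +-0-monoid; +-comm; +-suc; +-identityʳ; +-mono-≤
        ; *-identityʳ; *-zeroʳ; *-distribˡ-+; suc-injective; 0≢1+n; module ≤-Reasoning)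
open import Data.Nat.Combinatorics using (_C_; nCk+nC[k+1]≡[n+1]C[k+1])
open import Data.Fin using (Fin; zero; suc; _≟_)
open import Data.Fin.Subset using (Subset; inside; outside; _∩_; _∈_; _⊆_; ∣_∣; Nonempty)
open import Data.Fin.Subset.Properties using (nonempty?; x∈p∩q⁺; x∈p∩q⁻; Empty-unique; ∣⊥∣≡0)
open import Data.Vec using ([]; _∷_; tabulate; lookup)
open import Data.Vec.Properties using (lookup⇒[]=; []=⇒lookup; lookup∘tabulate)
open import Data.List using (List; []; _∷_; length; map)
open import Data.List.Properties using (length-map)
open import Data.List.Membership.Propositional renaming (_∈_ to _∈ᴸ_)
open import Data.List.Relation.Unary.Any using (here; there)
open import Data.List.Relation.Unary.All as All using (All; []; _∷_)
open import Data.List.Relation.Unary.All.Properties using (map⁺)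
open import Data.List.Relation.Unary.AllPairs using ([]; _∷_)
open import Data.List.Relation.Unary.Unique.Propositional using (Unique)
open import Data.Product using (_,_; proj₁; proj₂)
open import Data.Empty using (⊥-elim)
open import Function.Base using (id)
open import Function.Bundles using (Equivalence)
open import Relation.Nullary using (yes; no)
open import Relation.Nullary.Decidable using (⌊_⌋)
open import Relation.Binary.PropositionalEquality
open import Algebra.Properties.Monoid.Sum +-0-monoid using (sum-syntax)
open import Algebra.Properties.Semiring.Sum +-*-semiring
  using (sum; sum-cong-≗; ∑-distrib-+; *-distribʳ-sum)

Unique-map⁺ : ∀ {A B : Set} {P : A → Set} {f : A → B} →
  (∀ {x y} → P x → P y → x ≢ y → f x ≢ f y) →
  ∀ {xs} → All P xs → Unique xs → Unique (map f xs)
Unique-map⁺ inj [] [] = []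
Unique-map⁺ inj (px ∷ pxs) (x∉ ∷ u) =
  map⁺ (All.zipWith (λ (py , x≢y) → inj px py x≢y) (pxs , x∉)) ∷ Unique-map⁺ inj pxs u

outsideTails insideTails : ∀ {n} → List (Subset (suc n)) → List (Subset n)
outsideTails [] = []
outsideTails ((outside ∷ s) ∷ L) = s ∷ outsideTails L
outsideTails ((inside ∷ s) ∷ L) = outsideTails L
insideTails [] = []
insideTails ((outside ∷ s) ∷ L) = insideTails L
insideTails ((inside ∷ s) ∷ L) = s ∷ insideTails L

length-tails : ∀ {n} (L : List (Subset (suc n))) →
  length L ≡ length (outsideTails L) + length (insideTails L)
length-tails [] = refl
length-tails ((outside ∷ s) ∷ L) = cong suc (length-tails L)
length-tails ((inside ∷ s) ∷ L) = trans (cong suc (length-tails L)) (sym (+-suc _ _))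

∈-outsideTails⁻ : ∀ {n} (L : List (Subset (suc n))) {s} → s ∈ᴸ outsideTails L → (outside ∷ s) ∈ᴸ L
∈-outsideTails⁻ ((outside ∷ s) ∷ L) (here refl) = here refl
∈-outsideTails⁻ ((outside ∷ s) ∷ L) (there s∈) = there (∈-outsideTails⁻ L s∈)
∈-outsideTails⁻ ((inside ∷ s) ∷ L) s∈ = there (∈-outsideTails⁻ L s∈)

∈-insideTails⁻ : ∀ {n} (L : List (Subset (suc n))) {s} → s ∈ᴸ insideTails L → (inside ∷ s) ∈ᴸ L
∈-insideTails⁻ ((inside ∷ s) ∷ L) (here refl) = here refl
∈-insideTails⁻ ((inside ∷ s) ∷ L) (there s∈) = there (∈-insideTails⁻ L s∈)
∈-insideTails⁻ ((outside ∷ s) ∷ L) s∈ = there (∈-insideTails⁻ L s∈)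

outsideTails⁺ : ∀ {n} (L : List (Subset (suc n))) → Unique L → Unique (outsideTails L)
outsideTails⁺ [] [] = []
outsideTails⁺ ((outside ∷ s) ∷ L) (s∉ ∷ u) =
  All.tabulate (λ t∈ s≡t → All.lookup s∉ (∈-outsideTails⁻ L t∈) (cong (outside ∷_) s≡t)) ∷ outsideTails⁺ L u
outsideTails⁺ ((inside ∷ s) ∷ L) (_ ∷ u) = outsideTails⁺ L u

insideTails⁺ : ∀ {n} (L : List (Subset (suc n))) → Unique L → Unique (insideTails L)
insideTails⁺ [] [] = []
insideTails⁺ ((inside ∷ s) ∷ L) (s∉ ∷ u) =
  All.tabulate (λ t∈ s≡t → All.lookup s∉ (∈-insideTails⁻ L t∈) (cong (inside ∷_) s≡t)) ∷ insideTails⁺ L u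
insideTails⁺ ((outside ∷ s) ∷ L) (_ ∷ u) = insideTails⁺ L u

insideTails-∣∣≡0 : ∀ {n} (L : List (Subset (suc n))) → All (λ s → ∣ s ∣ ≡ 0) L → insideTails L ≡ []
insideTails-∣∣≡0 [] [] = refl
insideTails-∣∣≡0 ((outside ∷ s) ∷ L) (_ ∷ sizes) = insideTails-∣∣≡0 L sizes
insideTails-∣∣≡0 ((inside ∷ s) ∷ L) (() ∷ _)

outsideTails-∣∣ : ∀ {n k} (L : List (Subset (suc n))) →
  All (λ s → ∣ s ∣ ≡ k) L → All (λ s → ∣ s ∣ ≡ k) (outsideTails L)
outsideTails-∣∣ L sizes = All.tabulate (λ s∈ → All.lookup sizes (∈-outsideTails⁻ L s∈))

insideTails-∣∣ : ∀ {n k} (L : List (Subset (suc n))) →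
  All (λ s → ∣ s ∣ ≡ suc k) L → All (λ s → ∣ s ∣ ≡ k) (insideTails L)
insideTails-∣∣ L sizes = All.tabulate (λ s∈ → suc-injective (All.lookup sizes (∈-insideTails⁻ L s∈)))

length-ksubsets≤nCk : ∀ n k {L : List (Subset n)} → Unique L → All (λ s → ∣ s ∣ ≡ k) L → length L ≤ n C k
length-ksubsets≤nCk zero k {[]} _ _ = z≤n
length-ksubsets≤nCk zero zero {[] ∷ []} _ _ = s≤s z≤n
length-ksubsets≤nCk zero zero {[] ∷ [] ∷ _} ((≢[] ∷ _) ∷ _) _ = ⊥-elim (≢[] refl)
length-ksubsets≤nCk zero (suc k) {[] ∷ _} _ (() ∷ _)
length-ksubsets≤nCk (suc n) zero {L} u sizes = begin
  length L                                          ≡⟨ length-tails L ⟩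
  length (outsideTails L) + length (insideTails L)  ≡⟨ cong (λ I → length (outsideTails L) + length I) (insideTails-∣∣≡0 L sizes) ⟩
  length (outsideTails L) + 0                       ≡⟨ +-identityʳ _ ⟩
  length (outsideTails L)                           ≤⟨ length-ksubsets≤nCk n 0 (outsideTails⁺ L u) (outsideTails-∣∣ L sizes) ⟩
  1                                                 ∎
  where open ≤-Reasoning
length-ksubsets≤nCk (suc n) (suc k) {L} u sizes = begin
  length L                                          ≡⟨ length-tails L ⟩
  length (outsideTails L) + length (insideTails L)  ≤⟨ +-mono-≤ (length-ksubsets≤nCk n (suc k) (outsideTails⁺ L u) (outsideTails-∣∣ L sizes))
                                                                 (length-ksubsets≤nCk n k (insideTails⁺ L u) (insideTails-∣∣ L sizes)) ⟩
  n C suc k + n C k                                 ≡⟨ +-comm (n C suc k) (n C k) ⟩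
  n C k + n C suc k                                 ≡⟨ nCk+nC[k+1]≡[n+1]C[k+1] n k ⟩
  suc n C suc k                                     ∎
  where open ≤-Reasoning

𝟙 : Bool → ℕ
𝟙 true = 1
𝟙 false = 0

∣∷∣ : ∀ {n} b (p : Subset n) → ∣ b ∷ p ∣ ≡ 𝟙 b + ∣ p ∣
∣∷∣ true p = refl
∣∷∣ false p = refl

∑𝟙≡∣∣ : ∀ {r} (K : Subset r) → ∑[ i < r ] 𝟙 (lookup K i) ≡ ∣ K ∣
∑𝟙≡∣∣ [] = refl
∑𝟙≡∣∣ (b ∷ K) = trans (cong (𝟙 b +_) (∑𝟙≡∣∣ K)) (sym (∣∷∣ b K))

∑*0≡0 : ∀ {r} (f : Fin r → ℕ) → ∑[ i < r ] (f i * 0) ≡ 0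
∑*0≡0 f = trans (sym (*-distribʳ-sum 0 f)) (*-zeroʳ (sum f))

⌊suc≟suc⌋ : ∀ {r} (j i : Fin r) → ⌊ suc j ≟ suc i ⌋ ≡ ⌊ j ≟ i ⌋
⌊suc≟suc⌋ j i with j ≟ i
... | yes _ = refl
... | no _ = refl

∑*δ : ∀ {r} (f : Fin r → ℕ) j → ∑[ i < r ] (f i * 𝟙 ⌊ j ≟ i ⌋) ≡ f j
∑*δ {suc r} f zero =
  trans (cong₂ _+_ (*-identityʳ (f zero)) (∑*0≡0 (λ i → f (suc i)))) (+-identityʳ (f zero))
∑*δ {suc r} f (suc j) = begin
  f zero * 0 + ∑[ i < r ] (f (suc i) * 𝟙 ⌊ suc j ≟ suc i ⌋)  ≡⟨ cong₂ _+_ (*-zeroʳ (f zero)) (sum-cong-≗ shift) ⟩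
  ∑[ i < r ] (f (suc i) * 𝟙 ⌊ j ≟ i ⌋)                       ≡⟨ ∑*δ (λ i → f (suc i)) j ⟩
  f (suc j)                                                  ∎
  where
  open ≡-Reasoning
  shift : ∀ i → f (suc i) * 𝟙 ⌊ suc j ≟ suc i ⌋ ≡ f (suc i) * 𝟙 ⌊ j ≟ i ⌋
  shift i = cong (λ b → f (suc i) * 𝟙 b) (⌊suc≟suc⌋ j i)

⋃X : ∀ {n r} → (Fin n → Fin r) → Subset r → Subset n
⋃X part K = tabulate (λ v → lookup K (part v))

∣∩⋃X∣≡∑ : ∀ {n r} (part : Fin n → Fin r) (K : Subset r) (e : Subset n) →
  ∣ e ∩ ⋃X part K ∣ ≡ ∑[ i < r ] (𝟙 (lookup K i) * ∣ e ∩ X part i ∣)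
∣∩⋃X∣≡∑ part K [] = sym (∑*0≡0 (λ i → 𝟙 (lookup K i)))
∣∩⋃X∣≡∑ {r = r} part K (b ∷ e) = begin
  ∣ (b ∷ e) ∩ ⋃X part K ∣                            ≡⟨ ∣∷∣ (b ∧ lookup K (part zero)) (e ∩ ⋃X part′ K) ⟩
  𝟙 (b ∧ lookup K (part zero)) + ∣ e ∩ ⋃X part′ K ∣  ≡⟨ cong₂ _+_ (sym (∑w*δ b)) (∣∩⋃X∣≡∑ part′ K e) ⟩
  ∑[ i < r ] (w i * δ i) + ∑[ i < r ] (w i * c i)    ≡⟨ ∑-distrib-+ (λ i → w i * δ i) (λ i → w i * c i) ⟨
  ∑[ i < r ] (w i * δ i + w i * c i)                 ≡⟨ sum-cong-≗ (λ i → *-distribˡ-+ (w i) (δ i) (c i)) ⟨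
  ∑[ i < r ] (w i * (δ i + c i))                     ≡⟨ sum-cong-≗ (λ i → cong (w i *_) (∣∷∣ (b ∧ ⌊ part zero ≟ i ⌋) (e ∩ X part′ i))) ⟨
  ∑[ i < r ] (w i * ∣ (b ∷ e) ∩ X part i ∣)          ∎
  where
  open ≡-Reasoning
  part′ : Fin _ → Fin r
  part′ v = part (suc v)
  w δ c : Fin r → ℕ
  w i = 𝟙 (lookup K i)
  δ i = 𝟙 (b ∧ ⌊ part zero ≟ i ⌋)
  c i = ∣ e ∩ X part′ i ∣
  ∑w*δ : ∀ b → ∑[ i < r ] (w i * 𝟙 (b ∧ ⌊ part zero ≟ i ⌋)) ≡ 𝟙 (b ∧ lookup K (part zero))
  ∑w*δ true = ∑*δ w (part zero)
  ∑w*δ false = ∑*0≡0 w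

IsTransversal : ∀ {n r} → (Fin n → Fin r) → Subset n → Set
IsTransversal part e = ∀ i → ∣ e ∩ X part i ∣ ≡ 1

∣transversal∩⋃X∣≡∣K∣ : ∀ {n r} (part : Fin n → Fin r) (K : Subset r) {e} →
  IsTransversal part e → ∣ e ∩ ⋃X part K ∣ ≡ ∣ K ∣
∣transversal∩⋃X∣≡∣K∣ {r = r} part K {e} transversal = begin
  ∣ e ∩ ⋃X part K ∣                                ≡⟨ ∣∩⋃X∣≡∑ part K e ⟩
  ∑[ i < r ] (𝟙 (lookup K i) * ∣ e ∩ X part i ∣)   ≡⟨ sum-cong-≗ (λ i → trans (cong (𝟙 (lookup K i) *_) (transversal i)) (*-identityʳ _)) ⟩
  ∑[ i < r ] 𝟙 (lookup K i)                        ≡⟨ ∑𝟙≡∣∣ K ⟩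
  ∣ K ∣                                            ∎
  where open ≡-Reasoning

∣p∣≡1⇒Nonempty : ∀ {n} (p : Subset n) → ∣ p ∣ ≡ 1 → Nonempty p
∣p∣≡1⇒Nonempty {n} p ∣p∣≡1 with nonempty? p
... | yes nonempty = nonempty
... | no empty = ⊥-elim (0≢1+n (trans (sym (∣⊥∣≡0 n)) (trans (cong ∣_∣ (sym (Empty-unique empty))) ∣p∣≡1)))

∈X⇒part≡ : ∀ {n r} (part : Fin n → Fin r) {v i} → v ∈ X part i → part v ≡ i
∈X⇒part≡ part {v} {i} v∈ with part v ≟ i | trans (sym (lookup∘tabulate (λ w → ⌊ part w ≟ i ⌋) v)) ([]=⇒lookup v∈)
... | yes part≡ | _ = part≡
... | no _ | ()

∈⋃X⁺ : ∀ {n r} (part : Fin n → Fin r) K {v} → part v ∈ K → v ∈ ⋃X part K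
∈⋃X⁺ part K {v} part∈ = lookup⇒[]= v _ (trans (lookup∘tabulate (λ w → lookup K (part w)) v) ([]=⇒lookup part∈))

∈proj⁺ : ∀ {n r} (part : Fin n → Fin r) {g i} → Nonempty (g ∩ X part i) → i ∈ proj part g
∈proj⁺ part {g} {i} meets = lookup⇒[]= i _ (trans (lookup∘tabulate (λ j → ⌊ nonempty? (g ∩ X part j) ⌋) i) isYes≡true)
  where
  isYes≡true : ⌊ nonempty? (g ∩ X part i) ⌋ ≡ true
  isYes≡true with nonempty? (g ∩ X part i)
  ... | yes _ = refl
  ... | no misses = ⊥-elim (misses meets)

sameTrace⇒⊆proj∩ : ∀ {n r} (part : Fin n → Fin r) K {e f} → IsTransversal part e →
  e ∩ ⋃X part K ≡ f ∩ ⋃X part K → K ⊆ proj part (e ∩ f)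
sameTrace⇒⊆proj∩ part K {e} {f} transversal sameTrace {i} i∈K
  with v , v∈e∩Xi ← ∣p∣≡1⇒Nonempty (e ∩ X part i) (transversal i) =
  ∈proj⁺ part (v , x∈p∩q⁺ (x∈p∩q⁺ (v∈e , v∈f) , v∈Xi))
  where
  v∈e : v ∈ e
  v∈e = proj₁ (x∈p∩q⁻ e _ v∈e∩Xi)
  v∈Xi : v ∈ X part i
  v∈Xi = proj₂ (x∈p∩q⁻ e _ v∈e∩Xi)
  v∈⋃X : v ∈ ⋃X part K
  v∈⋃X = ∈⋃X⁺ part K (subst (_∈ K) (sym (∈X⇒part≡ part v∈Xi)) i∈K)
  v∈f : v ∈ f
  v∈f = proj₁ (x∈p∩q⁻ f _ (subst (v ∈_) sameTrace (x∈p∩q⁺ (v∈e , v∈⋃X))))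

lemma4p7 : (r n k : ℕ) → 1 ≤ r → (J : FamilyR r) → (part : Fin n → Fin r) → (H : Family n) →
    IsRPartite r part H → IsHomogeneous part J H → RankIs J k →
    length H ≤ n C k
lemma4p7 r n k _ J part H (unique , edges) (_ , _ , _ , pattern⇔J , _) ((K , uncovered , ∣K∣≡k) , _) =
  subst (_≤ n C k) (length-map trace H)
    (length-ksubsets≤nCk n k (Unique-map⁺ traces-distinct (All.tabulate id) unique) (map⁺ traces-sized))
  where
  trace : Subset n → Subset n
  trace e = e ∩ ⋃X part K
  traces-sized : All (λ e → ∣ trace e ∣ ≡ k) H
  traces-sized = All.map (λ {e} (_ , transversal) → trans (∣transversal∩⋃X∣≡∣K∣ part K {e} transversal) ∣K∣≡k) edges
  traces-distinct : ∀ {e f} → e ∈ᴸ H → f ∈ᴸ H → e ≢ f → trace e ≢ trace f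
  traces-distinct {e} {f} e∈H f∈H e≢f sameTrace =
    uncovered (proj part (e ∩ f)) proj∈J (sameTrace⇒⊆proj∩ part K (proj₂ (All.lookup edges e∈H)) sameTrace)
    where
    proj∈J : J (proj part (e ∩ f))
    proj∈J = Equivalence.to (pattern⇔J e e∈H _) (e ∩ f , (f , f∈H , (λ f≡e → e≢f (sym f≡e)) , refl) , refl)
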